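{- For every integer $n\geq 1$: (a) $\sum_{k=1}^{n}GM_{k}=\frac{1}{3}\left(GM_{n+2}+2GM_{n}+GM_{n-1}-(1+i)\right)$; (b) $\sum_{k=1}^{n}GM_{2k+1}=\frac{1}{3}\left(2GM_{2n+2}+GM_{2n}-GM_{2n-1}-2-2i\right)$; (c) $\sum_{k=1}^{n}GM_{2k}=\frac{1}{3}\left(2GM_{2n+1}+GM_{2n-1}-GM_{2n-2}-2+i\right)$.
   Context: The Gaussian Tetranacci numbers $GM_n$ are defined by $GM_{n}=GM_{n-1}+GM_{n-2}+GM_{n-3}+GM_{n-4}$ with $GM_{0}=0$, $GM_{1}=1$, $GM_{2}=1+i$, $GM_{3}=2+i$ (equivalently $GM_n=M_n+iM_{n-1}$, where $M_n$ are the Tetranacci numbers $M_0=0,M_1=1,M_2=1,M_3=2$, $M_n=M_{n-1}+M_{n-2}+M_{n-3}+M_{n-4}$), extended to negative indices via $GM_{ -n}=-GM_{ -(n-1)}-GM_{ -(n-2)}-GM_{ -(n-3)}+GM_{ -(n-4)}$. -}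

module Defs where

open import Data.Nat using (ℕ; zero; suc)
open import Data.Integer using (ℤ; +_; -[1+_]) renaming (_+_ to _+ℤ_; _*_ to _*ℤ_)
open import Data.Product using (_×_; _,_)

record ℤ[i] : Set where
  constructor _+_i
  field
    re : ℤ
    im : ℤ
open ℤ[i] public

infixl 6 _⊕_
_⊕_ : ℤ[i] → ℤ[i] → ℤ[i]
(a + b i) ⊕ (c + d i) = (a +ℤ c) + (b +ℤ d) i

⊖_ : ℤ[i] → ℤ[i]
⊖ (a + b i) = Data.Integer.-_ a + Data.Integer.-_ b i

infixl 6 _⊝_
_⊝_ : ℤ[i] → ℤ[i] → ℤ[i]
x ⊝ y = x ⊕ (⊖ y)

infixl 7 _·_
_·_ : ℤ → ℤ[i] → ℤ[i]
k · (a + b i) = (k *ℤ a) + (k *ℤ b) i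

0G : ℤ[i]
0G = (+ 0) + (+ 0) i

GM : ℕ → ℤ[i]
GM 0 = 0G
GM 1 = (+ 1) + (+ 0) i
GM 2 = (+ 1) + (+ 1) i
GM 3 = (+ 2) + (+ 1) i
GM (suc (suc (suc (suc n)))) =
  GM (suc (suc (suc n))) ⊕ GM (suc (suc n)) ⊕ GM (suc n) ⊕ GM n

sumFrom1 : ℕ → (ℕ → ℤ[i]) → ℤ[i]
sumFrom1 zero f = 0G
sumFrom1 (suc n) f = sumFrom1 n f ⊕ f (suc n)

module Submission where

open import Defs
open import Data.Nat using (ℕ; zero; suc; _+_; _*_; _∸_; _≥_; s≤s)
open import Data.Nat.Properties using (+-comm; *-suc)
open import Data.Integer using (ℤ; +_; -[1+_]; -_) renaming (_+_ to _+ℤ_; _*_ to _*ℤ_)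
open import Data.Integer.Properties using (*-distribˡ-+)
open import Data.Integer.Tactic.RingSolver using (solve-∀)
open import Data.Product using (_×_; _,_)
open import Relation.Binary.PropositionalEquality using (_≡_; refl; cong; cong₂; module ≡-Reasoning)

-- Cleared of the factor 1/3, each formula reads 3 · Σ_{k=1}^{n} f k = R n and follows by
-- induction on n from the increment identity R n + 3 · f (n + 1) = R (n + 1). Unfolding the
-- Tetranacci recurrence turns that identity into a linear one between four consecutive
-- values of GM; as ℤ[i] is operated on componentwise, the ring solver on ℤ checks it for the
-- real and the imaginary parts separately.

componentwise : ∀ {x y : ℤ[i]} → re x ≡ re y → im x ≡ im y → x ≡ y
componentwise {_ + _ i} {_ + _ i} refl refl = refl

·-distribˡ-⊕ : ∀ k x y → k · (x ⊕ y) ≡ k · x ⊕ k · y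
·-distribˡ-⊕ k (a + b i) (c + d i) = cong₂ _+_i (*-distribˡ-+ k a c) (*-distribˡ-+ k b d)

·-sumFrom1-telescope : ∀ k (f R : ℕ → ℤ[i]) →
  k · sumFrom1 1 f ≡ R 0 →
  (∀ m → R m ⊕ k · f (suc (suc m)) ≡ R (suc m)) →
  ∀ m → k · sumFrom1 (suc m) f ≡ R m
·-sumFrom1-telescope k f R base step zero = base
·-sumFrom1-telescope k f R base step (suc m) = begin
  k · (sumFrom1 (suc m) f ⊕ f (suc (suc m)))     ≡⟨ ·-distribˡ-⊕ k _ _ ⟩
  k · sumFrom1 (suc m) f ⊕ k · f (suc (suc m))  ≡⟨ cong (_⊕ k · f (suc (suc m))) (·-sumFrom1-telescope k f R base step m) ⟩
  R m ⊕ k · f (suc (suc m))                      ≡⟨ step m ⟩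
  R (suc m)                                      ∎
  where open ≡-Reasoning

step-at-evens : ∀ (F f : ℕ → ℤ[i]) →
  (∀ j → F (2 + j) ⊕ f (4 + j) ≡ F (4 + j)) →
  ∀ m → F (2 * suc m) ⊕ f (2 * suc (suc m)) ≡ F (2 * suc (suc m))
step-at-evens F f step m rewrite *-suc 2 (suc m) | *-suc 2 m = step (2 * m)

-- The closed forms of (b) and (c) take j = 2n as argument, so their steps go from j to j + 2.
sumClosedForm : ℕ → ℤ[i]
sumClosedForm n = GM (n + 2) ⊕ (+ 2) · GM n ⊕ GM (n ∸ 1) ⊝ ((+ 1) + (+ 1) i)

oddSumClosedForm : ℕ → ℤ[i]
oddSumClosedForm j = (+ 2) · GM (j + 2) ⊕ GM j ⊝ GM (j ∸ 1) ⊝ ((+ 2) + (+ 2) i)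

evenSumClosedForm : ℕ → ℤ[i]
evenSumClosedForm j = (+ 2) · GM (j + 1) ⊕ GM (j ∸ 1) ⊝ GM (j ∸ 2) ⊕ (-[1+ 1 ] + (+ 1) i)

sumClosedForm-step : ∀ m → sumClosedForm (1 + m) ⊕ (+ 3) · GM (2 + m) ≡ sumClosedForm (2 + m)
sumClosedForm-step m rewrite +-comm m 2 = componentwise
  (identity (re (GM m)) (re (GM (1 + m))) (re (GM (2 + m))) (re (GM (3 + m))) (+ 1))
  (identity (im (GM m)) (im (GM (1 + m))) (im (GM (2 + m))) (im (GM (3 + m))) (+ 1))
  where
  identity : ∀ (g₀ g₁ g₂ g₃ c : ℤ) →
    (g₃ +ℤ + 2 *ℤ g₁ +ℤ g₀ +ℤ - c) +ℤ + 3 *ℤ g₂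
      ≡ (g₃ +ℤ g₂ +ℤ g₁ +ℤ g₀) +ℤ + 2 *ℤ g₂ +ℤ g₁ +ℤ - c
  identity = solve-∀

oddSumClosedForm-step : ∀ j → oddSumClosedForm (2 + j) ⊕ (+ 3) · GM (4 + j + 1) ≡ oddSumClosedForm (4 + j)
oddSumClosedForm-step j rewrite +-comm j 2 | +-comm j 1 = componentwise
  (identity (re (GM (1 + j))) (re (GM (2 + j))) (re (GM (3 + j))) (re (GM (4 + j))) (+ 2))
  (identity (im (GM (1 + j))) (im (GM (2 + j))) (im (GM (3 + j))) (im (GM (4 + j))) (+ 2))
  where
  identity : ∀ (g₁ g₂ g₃ g₄ c : ℤ) →
    (+ 2 *ℤ g₄ +ℤ g₂ +ℤ - g₁ +ℤ - c) +ℤ + 3 *ℤ (g₄ +ℤ g₃ +ℤ g₂ +ℤ g₁)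
      ≡ + 2 *ℤ ((g₄ +ℤ g₃ +ℤ g₂ +ℤ g₁) +ℤ g₄ +ℤ g₃ +ℤ g₂) +ℤ g₄ +ℤ - g₃ +ℤ - c
  identity = solve-∀

evenSumClosedForm-step : ∀ j → evenSumClosedForm (2 + j) ⊕ (+ 3) · GM (4 + j) ≡ evenSumClosedForm (4 + j)
evenSumClosedForm-step j rewrite +-comm j 1 = componentwise
  (identity (re (GM j)) (re (GM (1 + j))) (re (GM (2 + j))) (re (GM (3 + j))) -[1+ 1 ])
  (identity (im (GM j)) (im (GM (1 + j))) (im (GM (2 + j))) (im (GM (3 + j))) (+ 1))
  where
  identity : ∀ (g₀ g₁ g₂ g₃ c : ℤ) →
    (+ 2 *ℤ g₃ +ℤ g₁ +ℤ - g₀ +ℤ c) +ℤ + 3 *ℤ (g₃ +ℤ g₂ +ℤ g₁ +ℤ g₀)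
      ≡ + 2 *ℤ ((g₃ +ℤ g₂ +ℤ g₁ +ℤ g₀) +ℤ g₃ +ℤ g₂ +ℤ g₁) +ℤ g₃ +ℤ - g₂ +ℤ c
  identity = solve-∀

mainTheorem5 : (n : ℕ) → n ≥ 1 →
    ((+ 3) · sumFrom1 n GM
        ≡ GM (n + 2) ⊕ (+ 2) · GM n ⊕ GM (n Data.Nat.∸ 1) ⊝ ((+ 1) + (+ 1) i))
    × ((+ 3) · sumFrom1 n (λ k → GM (2 * k + 1))
        ≡ (+ 2) · GM (2 * n + 2) ⊕ GM (2 * n) ⊝ GM (2 * n Data.Nat.∸ 1) ⊝ ((+ 2) + (+ 2) i))
    × ((+ 3) · sumFrom1 n (λ k → GM (2 * k))
        ≡ (+ 2) · GM (2 * n + 1) ⊕ GM (2 * n Data.Nat.∸ 1) ⊝ GM (2 * n Data.Nat.∸ 2) ⊕ (-[1+ 1 ] + (+ 1) i))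
mainTheorem5 (suc m) (s≤s _) =
    ·-sumFrom1-telescope (+ 3) GM (λ k → sumClosedForm (suc k)) refl sumClosedForm-step m
  , ·-sumFrom1-telescope (+ 3) (λ k → GM (2 * k + 1)) (λ k → oddSumClosedForm (2 * suc k)) refl
      (step-at-evens oddSumClosedForm (λ j → (+ 3) · GM (j + 1)) oddSumClosedForm-step) m
  , ·-sumFrom1-telescope (+ 3) (λ k → GM (2 * k)) (λ k → evenSumClosedForm (2 * suc k)) refl
      (step-at-evens evenSumClosedForm (λ j → (+ 3) · GM j) evenSumClosedForm-step) m
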